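{- Let $n\ge1$ and $N=2^n$. For any non-trivial graph $G\subseteq[N]\times[N]$ (i.e. $G\ne\emptyset$, $G\ne[N]\times[N]$), $\rho(G,\mathcal G_{N,N})\le D_\cap(f_G^{ -1}(1)\mid\mathcal B_{2n})$.
   Context: A sequence $A_1,\dots,A_t$ ($t\ge1$) of subsets of $\Gamma$ generates $A$ from $\mathcal B$ if $A_t=A$ and each $A_i$ equals $X\cup Y$ or $X\cap Y$ for some (not necessarily distinct) $X,Y\in\mathcal B\cup\{A_1,\dots,A_{i-1}\}$. $D_\cap(A\mid\mathcal B)$ is the minimum number of intersection steps over all sequences generating $A$ from $\mathcal B$ ($\infty$ if none). Cover complexity: for $A\subseteq\Gamma$ let $U=\Gamma\setminus A$. A semi-filter over $U$ is a nonempty family $\mathcal F\subseteq\mathcal P(U)$ with $\emptyset\notin\mathcal F$ such that $U_1\in\mathcal F$, $U_1\subseteq U_2\subseteq U$ imply $U_2\in\mathcal F$. $\mathcal F$ is above $w\in\Gamma$ if $B\cap U\in\mathcal F$ for every $B\in\mathcal B$ with $w\in B$. $\mathcal F$ preserves a pair $(E,H)$ of subsets of $U$ if $E,H\in\mathcal F$ imply $E\cap H\in\mathcal F$. $\rho(A,\mathcal B)$ is the minimum size of a collection $\Lambda$ of pairs of subsets of $U$ such that no semi-filter over $U$ preserving every pair of $\Lambda$ is above some $a\in A$ ($\infty$ if none). $\mathcal G_{N,N}=\{R_1,\dots,R_N,C_1,\dots,C_N\}$ on $[N]\times[N]$, $R_i=\{(i,j):j\in[N]\}$, $C_j=\{(i,j):i\in[N]\}$.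 $\mathcal B_{2n}=\{B_1,\dots,B_{2n},B_1^c,\dots,B_{2n}^c\}$ on $\{0,1\}^{2n}$, $B_i=\{v:v_i=1\}$. $\mathrm{bin}\colon[N]\to\{0,1\}^n$ maps $k$ to the $n$-bit binary representation (most significant bit first) of $k-1$; $\phi(u,v)=\mathrm{bin}(u)\mathrm{bin}(v)$ (concatenation); $f_G\colon\{0,1\}^{2n}\to\{0,1\}$ is given by $f_G^{ -1}(1)=\phi(G)$. -}

module Defs where

open import Data.Bool using (Bool; true; false; _∧_; _∨_; not; if_then_else_)
open import Data.Nat using (ℕ; zero; suc; _+_; _^_; _∸_; _≤_; _≤ᵇ_)
open import Data.Fin using (Fin; toℕ)
import Data.Fin as Fin
open import Data.Vec using (Vec; []; _∷_; _++_; lookup; _∷ʳ_; last)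
open import Data.Vec.Properties using (≡-dec)
import Data.Bool as Bool
open import Data.List using (List; length; allFin; cartesianProduct)
open import Data.Bool.ListAction using (any)
open import Data.List.Relation.Unary.All using (All)
open import Data.Product using (Σ; _×_; _,_; proj₁; proj₂)
open import Data.Sum using (_⊎_; inj₁; inj₂)
open import Relation.Nullary using (¬_)
open import Relation.Nullary.Decidable using (⌊_⌋)
open import Relation.Binary.PropositionalEquality using (_≡_)

Subset : Set → Set
Subset Γ = Γ → Bool

module _ {Γ : Set} where
  _∪ˢ_ : Subset Γ → Subset Γ → Subset Γ
  (X ∪ˢ Y) x = X x ∨ Y x

  _∩ˢ_ : Subset Γ → Subset Γ → Subset Γ
  (X ∩ˢ Y) x = X x ∧ Y x

  ∁ : Subset Γ → Subset Γ
  ∁ X x = not (X x)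

  ∅ˢ : Subset Γ
  ∅ˢ _ = false

  _⊆ˢ_ : Subset Γ → Subset Γ → Set
  X ⊆ˢ Y = ∀ x → X x ≡ true → Y x ≡ true

  _≐_ : Subset Γ → Subset Γ → Set
  X ≐ Y = ∀ x → X x ≡ Y x

-- A sequence of length p is built step by step; step number p may use as
-- operands members of ℬ (inj₁ i) or earlier sets A_1..A_p (inj₂ j, j : Fin p).

data Op : Set where
  ∪op ∩op : Op

Operand : Set → ℕ → Set
Operand I p = I ⊎ Fin p

record Step (I : Set) (p : ℕ) : Set where
  constructor step
  field
    op  : Op
    lhs : Operand I p
    rhs : Operand I p

data Steps (I : Set) : ℕ → Set where
  []  : Steps I 0
  _▷_ : ∀ {p} → Steps I p → Step I p → Steps I (suc p)

module _ {Γ I : Set} (ℬ : I → Subset Γ) where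
  applyOp : Op → Subset Γ → Subset Γ → Subset Γ
  applyOp ∪op X Y = X ∪ˢ Y
  applyOp ∩op X Y = X ∩ˢ Y

  operand : ∀ {p} → Vec (Subset Γ) p → Operand I p → Subset Γ
  operand env (inj₁ i) = ℬ i
  operand env (inj₂ j) = lookup env j

  evalSteps : ∀ {p} → Steps I p → Vec (Subset Γ) p
  evalSteps []       = []
  evalSteps (s ▷ step o l r) =
    let env = evalSteps s in env ∷ʳ applyOp o (operand env l) (operand env r)

  countCap : ∀ {p} → Steps I p → ℕ
  countCap [] = 0
  countCap (s ▷ step ∪op _ _) = countCap s
  countCap (s ▷ step ∩op _ _) = suc (countCap s)

  Generates : ∀ {t} → Steps I (suc t) → Subset Γ → Set
  Generates s A = last (evalSteps s) ≐ A

  -- there is a sequence generating A from ℬ using exactly k intersection steps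
  -- (so D_∩(A ∣ ℬ) = min of such k, or ∞ if there is none)
  GeneratedWithCaps : Subset Γ → ℕ → Set
  GeneratedWithCaps A k =
    Σ ℕ λ t → Σ (Steps I (suc t)) λ s → Generates s A × countCap s ≡ k

module _ {Γ I : Set} (ℬ : I → Subset Γ) (A : Subset Γ) where
  U : Subset Γ
  U = ∁ A

  record SemiFilter (F : Subset Γ → Bool) : Set where
    field
      nonempty  : Σ (Subset Γ) λ X → F X ≡ true
      overU     : ∀ X → F X ≡ true → X ⊆ˢ U
      noEmpty   : F ∅ˢ ≡ false
      upClosed  : ∀ X Y → F X ≡ true → X ⊆ˢ Y → Y ⊆ˢ U → F Y ≡ true

  Above : (Subset Γ → Bool) → Γ → Set
  Above F w = ∀ i → ℬ i w ≡ true → F (ℬ i ∩ˢ U) ≡ true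

  Preserves : (Subset Γ → Bool) → Subset Γ × Subset Γ → Set
  Preserves F (E , H) = F E ≡ true → F H ≡ true → F (E ∩ˢ H) ≡ true

  PairOverU : Subset Γ × Subset Γ → Set
  PairOverU (E , H) = E ⊆ˢ U × H ⊆ˢ U

  Witness : List (Subset Γ × Subset Γ) → Set
  Witness Λ =
    All PairOverU Λ ×
    ¬ (Σ (Subset Γ → Bool) λ F → SemiFilter F × All (Preserves F) Λ ×
        Σ Γ λ a → A a ≡ true × Above F a)

  ρ≤ : ℕ → Set
  ρ≤ k = Σ (List (Subset Γ × Subset Γ)) λ Λ → length Λ ≤ k × Witness Λ

-- grid 𝒢_{N,N} on [N]×[N] (here [N] = Fin N): rows inj₁ i, columns inj₂ j
grid : (N : ℕ) → Fin N ⊎ Fin N → Subset (Fin N × Fin N)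
grid N (inj₁ i) (a , b) = ⌊ a Fin.≟ i ⌋
grid N (inj₂ j) (a , b) = ⌊ b Fin.≟ j ⌋

-- ℬ_{m} on {0,1}^m : (i , true) ↦ B_i = {v | v_i = 1}, (i , false) ↦ B_i^c
cube : (m : ℕ) → Fin m × Bool → Subset (Vec Bool m)
cube m (i , true)  v = lookup v i
cube m (i , false) v = not (lookup v i)

-- n-bit binary representation, most significant bit first (true = 1)
binℕ : (n : ℕ) → ℕ → Vec Bool n
binℕ zero    m = []
binℕ (suc n) m =
  if 2 ^ n ≤ᵇ m then true ∷ binℕ n (m ∸ 2 ^ n) else false ∷ binℕ n m

-- bin k = binary of k-1 for k ∈ [N]; with [N] = Fin N the element k is
-- represented by Fin index k-1 = toℕ
bin : (n : ℕ) → Fin (2 ^ n) → Vec Bool n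
bin n k = binℕ n (toℕ k)

φ : (n : ℕ) → Fin (2 ^ n) × Fin (2 ^ n) → Vec Bool (n + n)
φ n (u , v) = bin n u ++ bin n v

fG⁻¹1 : (n : ℕ) → Subset (Fin (2 ^ n) × Fin (2 ^ n)) → Subset (Vec Bool (n + n))
fG⁻¹1 n G w =
  any (λ g → G g ∧ ⌊ ≡-dec Bool._≟_ (φ n g) w ⌋)
      (cartesianProduct (allFin (2 ^ n)) (allFin (2 ^ n)))

NonTrivial : ∀ {Γ} → Subset Γ → Set
NonTrivial {Γ} G = (Σ Γ λ x → G x ≡ true) × (Σ Γ λ x → G x ≡ false)

{-# OPTIONS --safe #-}
module Submission where

-- Pull a generating sequence for φ(G) back along the injective map φ: it generates G from the
-- preimages of the cube sets, with the same number of intersection steps.  For every intersection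
-- step X ∩ Y record the pair (X ∖ G , Y ∖ G).  A semi-filter preserving these pairs and above
-- some a ∈ G contains X ∖ G for every set X ∋ a of the sequence,
-- hence contains G ∖ G = ∅, which is impossible.  Being above a for the grid suffices, because
-- each cube set containing φ(a) contains the row or the column through a fixing the relevant bit.

open import Defs
open import Data.Bool using (Bool; true; false; _∧_; _∨_; not; T)
import Data.Bool as Bool
open import Data.Bool.Properties using (∧-inverseʳ; T-≡; T-∧; ⇔→≡)
open import Data.Empty using (⊥)
open import Data.Fin using (Fin; splitAt; toℕ)
import Data.Fin as Fin
open import Data.Fin.Properties using (toℕ-injective; toℕ<n)
open import Data.List using (List; []; _∷_; length; allFin; cartesianProduct)
open import Data.List.Membership.Propositional.Properties using (∈-cartesianProduct⁺; ∈-allFin)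
open import Data.List.Relation.Unary.All using (All; []; _∷_)
import Data.List.Relation.Unary.Any as Any
open import Data.List.Relation.Unary.Any.Properties using (any⁺; any⁻)
open import Data.Nat using (ℕ; zero; suc; _+_; _∸_; _^_; _≤_; _<_; _≤ᵇ_; s≤s)
open import Data.Nat.Properties using (≤-reflexive; ≤ᵇ⇒≤; ≤⇒≤ᵇ; ≰⇒>; m<n+o⇒m∸n<o; m+[n∸m]≡n; +-identityʳ; m^n≢0)
open import Data.Product using (Σ; _×_; _,_; proj₁; proj₂)
open import Data.Sum using (_⊎_; inj₁; inj₂; [_,_]′)
import Data.Sum as Sum
open import Data.Unit using (tt)
open import Data.Vec using (Vec; []; _∷_; lookup; _∷ʳ_; last; map)
open import Data.Vec.Properties using (≡-dec; lookup-splitAt; ++-injective; map-∷ʳ; lookup-map)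
import Data.Vec.Relation.Unary.All as Vecᴬ
open import Data.Vec.Relation.Unary.All.Properties using (lookup⁺)
open import Function using (_∘_; const; mk⇔; Equivalence)
open import Relation.Nullary using (Dec)
open import Relation.Nullary.Decidable using (⌊_⌋; toWitness; isYes≗does; dec-true)
open import Relation.Binary.PropositionalEquality using (_≡_; refl; sym; trans; cong; cong₂; cong-app; subst; module ≡-Reasoning)

private
  variable
    Γ Δ I J : Set
    X Y A : Subset Γ
    n p k : ℕ

∨-true⁻ : ∀ x {y} → x ∨ y ≡ true → x ≡ true ⊎ y ≡ true
∨-true⁻ true  _ = inj₁ refl
∨-true⁻ false e = inj₂ e

∧-true⁻ : ∀ x {y} → x ∧ y ≡ true → x ≡ true × y ≡ true
∧-true⁻ true e = refl , e

∧-true⁺ : ∀ {x y} → x ≡ true → y ≡ true → x ∧ y ≡ true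
∧-true⁺ refl refl = refl

isYes-true⁻ : {P : Set} (d : Dec P) → ⌊ d ⌋ ≡ true → P
isYes-true⁻ d e = toWitness (Equivalence.from T-≡ e)

isYes-true⁺ : {P : Set} (d : Dec P) → P → ⌊ d ⌋ ≡ true
isYes-true⁺ d x = trans (isYes≗does d) (dec-true d x)

last-map : ∀ {A B : Set} (f : A → B) (xs : Vec A (suc n)) → last (map f xs) ≡ f (last xs)
last-map f (x ∷ [])     = refl
last-map f (x ∷ y ∷ xs) = last-map f (y ∷ xs)

All-∷ʳ⁺ : ∀ {A : Set} {P : A → Set} {xs : Vec A n} {y} → Vecᴬ.All P xs → P y → Vecᴬ.All P (xs ∷ʳ y)
All-∷ʳ⁺ Vecᴬ.[]         py = py Vecᴬ.∷ Vecᴬ.[]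
All-∷ʳ⁺ (px Vecᴬ.∷ pxs) py = px Vecᴬ.∷ All-∷ʳ⁺ pxs py

All-last : ∀ {A : Set} {P : A → Set} {xs : Vec A (suc n)} → Vecᴬ.All P xs → P (last xs)
All-last (px Vecᴬ.∷ Vecᴬ.[])          = px
All-last (_ Vecᴬ.∷ pxs@(_ Vecᴬ.∷ _)) = All-last pxs

infix 25 _∖ˢ_

_∖ˢ_ : Subset Γ → Subset Γ → Subset Γ
X ∖ˢ A = X ∩ˢ ∁ A

∖ˢ-⊆-∁ : X ∖ˢ A ⊆ˢ ∁ A
∖ˢ-⊆-∁ {X = X} x e = proj₂ (∧-true⁻ (X x) e)

∖ˢ-mono : X ⊆ˢ Y → X ∖ˢ A ⊆ˢ Y ∖ˢ A
∖ˢ-mono {X = X} X⊆Y x e = let x∈X , x∉A = ∧-true⁻ (X x) e in ∧-true⁺ (X⊆Y x x∈X) x∉A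

∪ˢ-upperˡ : X ⊆ˢ (X ∪ˢ Y)
∪ˢ-upperˡ x e rewrite e = refl

∪ˢ-upperʳ : Y ⊆ˢ (X ∪ˢ Y)
∪ˢ-upperʳ {X = X} x e with X x
... | true  = refl
... | false = e

∖ˢ-∩ˢ : ((X ∖ˢ A) ∩ˢ (Y ∖ˢ A)) ⊆ˢ (X ∩ˢ Y) ∖ˢ A
∖ˢ-∩ˢ {X = X} {Y = Y} x e =
  let x∈X∖A , x∈Y∖A = ∧-true⁻ (X x ∧ _) e
      x∈X , x∉A = ∧-true⁻ (X x) x∈X∖A
      x∈Y , _   = ∧-true⁻ (Y x) x∈Y∖A
  in ∧-true⁺ (∧-true⁺ x∈X x∈Y) x∉A

≐-∖ˢ-empty : X ≐ A → X ∖ˢ A ⊆ˢ ∅ˢ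
≐-∖ˢ-empty {X = X} {A = A} X≐A x e =
  trans (sym (trans (cong (_∧ not (A x)) (X≐A x)) (∧-inverseʳ (A x)))) e

module _ {F : Subset Γ → Bool} {ℬ : I → Subset Γ} (SF : SemiFilter ℬ A F) where
  open SemiFilter SF

  semiFilter-∖ˢ-mono : X ⊆ˢ Y → F (X ∖ˢ A) ≡ true → F (Y ∖ˢ A) ≡ true
  semiFilter-∖ˢ-mono X⊆Y X∖A∈F = upClosed _ _ X∖A∈F (∖ˢ-mono X⊆Y) ∖ˢ-⊆-∁

  semiFilter-≐-absurd : X ≐ A → F (X ∖ˢ A) ≡ true → ⊥
  semiFilter-≐-absurd X≐A X∖A∈F with () ← trans (sym noEmpty) (upClosed _ _ X∖A∈F (≐-∖ˢ-empty X≐A) (λ _ ()))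

module _ (ℬ : I → Subset Γ) (A : Subset Γ) where

  capPairs : Steps I p → List (Subset Γ × Subset Γ)
  capPairs []                 = []
  capPairs (s ▷ step ∪op _ _) = capPairs s
  capPairs (s ▷ step ∩op l r) =
    (operand ℬ (evalSteps ℬ s) l ∖ˢ A , operand ℬ (evalSteps ℬ s) r ∖ˢ A) ∷ capPairs s

  length-capPairs : (s : Steps I p) → length (capPairs s) ≡ countCap ℬ s
  length-capPairs []                 = refl
  length-capPairs (s ▷ step ∪op _ _) = length-capPairs s
  length-capPairs (s ▷ step ∩op _ _) = cong suc (length-capPairs s)

  capPairs-overU : (s : Steps I p) → All (PairOverU ℬ A) (capPairs s)
  capPairs-overU []                 = []
  capPairs-overU (s ▷ step ∪op _ _) = capPairs-overU s
  capPairs-overU (s ▷ step ∩op _ _) = (∖ˢ-⊆-∁ , ∖ˢ-⊆-∁) ∷ capPairs-overU s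

  module _ {F : Subset Γ → Bool} (SF : SemiFilter ℬ A F) {a : Γ} (above : Above ℬ A F a) where

    AboveIn : Subset Γ → Set
    AboveIn X = X a ≡ true → F (X ∖ˢ A) ≡ true

    aboveIn-∪ˢ : AboveIn X → AboveIn Y → AboveIn (X ∪ˢ Y)
    aboveIn-∪ˢ {X = X} aboveX aboveY a∈X∪Y with ∨-true⁻ (X a) a∈X∪Y
    ... | inj₁ a∈X = semiFilter-∖ˢ-mono SF ∪ˢ-upperˡ (aboveX a∈X)
    ... | inj₂ a∈Y = semiFilter-∖ˢ-mono SF (∪ˢ-upperʳ {X = X}) (aboveY a∈Y)

    aboveIn-∩ˢ : Preserves ℬ A F (X ∖ˢ A , Y ∖ˢ A) → AboveIn X → AboveIn Y → AboveIn (X ∩ˢ Y)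
    aboveIn-∩ˢ {X = X} {Y = Y} pres aboveX aboveY a∈X∩Y =
      let a∈X , a∈Y = ∧-true⁻ (X a) a∈X∩Y
      in SemiFilter.upClosed SF _ _ (pres (aboveX a∈X) (aboveY a∈Y)) (∖ˢ-∩ˢ {X = X} {Y = Y}) ∖ˢ-⊆-∁

    aboveIn-operand : {env : Vec (Subset Γ) p} → Vecᴬ.All AboveIn env → (o : Operand I p) → AboveIn (operand ℬ env o)
    aboveIn-operand _     (inj₁ i) = above i
    aboveIn-operand abovs (inj₂ j) = lookup⁺ abovs j

    aboveIn-evalSteps : (s : Steps I p) → All (Preserves ℬ A F) (capPairs s) → Vecᴬ.All AboveIn (evalSteps ℬ s)
    aboveIn-evalSteps []                 _            = Vecᴬ.[]
    aboveIn-evalSteps (s ▷ step ∪op l r) pres         =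
      let abovs = aboveIn-evalSteps s pres
      in All-∷ʳ⁺ abovs (aboveIn-∪ˢ (aboveIn-operand abovs l) (aboveIn-operand abovs r))
    aboveIn-evalSteps (s ▷ step ∩op l r) (pres ∷ ps) =
      let abovs = aboveIn-evalSteps s ps
      in All-∷ʳ⁺ abovs (aboveIn-∩ˢ pres (aboveIn-operand abovs l) (aboveIn-operand abovs r))

  ρ≤-generatedWithCaps : GeneratedWithCaps ℬ A k → ρ≤ ℬ A k
  ρ≤-generatedWithCaps (_ , s , generates , refl) =
    capPairs s , ≤-reflexive (length-capPairs s) , capPairs-overU s ,
    λ (F , SF , pres , a , a∈A , above) →
      semiFilter-≐-absurd SF generates
        (All-last (aboveIn-evalSteps SF above s pres) (trans (generates a) a∈A))

Finer : (I → Subset Γ) → (J → Subset Γ) → Set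
Finer {I = I} ℬ 𝒞 = ∀ w j → 𝒞 j w ≡ true → Σ I λ i → ℬ i w ≡ true × ℬ i ⊆ˢ 𝒞 j

module _ {ℬ : I → Subset Γ} {𝒞 : J → Subset Γ} (ℬ≼𝒞 : Finer ℬ 𝒞) where

  ρ≤-finer : ρ≤ 𝒞 A k → ρ≤ ℬ A k
  ρ≤-finer (Λ , |Λ|≤k , overU , noFilter) =
    Λ , |Λ|≤k , overU ,
    λ (F , SF , pres , a , a∈A , above) →
      -- only the record type of a semi-filter mentions the base family, not its fields
      noFilter (F , record { SemiFilter SF } , pres , a , a∈A , λ j a∈𝒞j →
        let i , a∈ℬi , ℬi⊆𝒞j = ℬ≼𝒞 a j a∈𝒞j
        in semiFilter-∖ˢ-mono SF ℬi⊆𝒞j (above i a∈ℬi))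

pullback : (Γ → Δ) → (I → Subset Δ) → I → Subset Γ
pullback ψ 𝒞 i = 𝒞 i ∘ ψ

module _ (ψ : Γ → Δ) (𝒞 : I → Subset Δ) where

  applyOp-pullback : ∀ o (X Y : Subset Δ) →
    applyOp (pullback ψ 𝒞) o (X ∘ ψ) (Y ∘ ψ) ≡ applyOp 𝒞 o X Y ∘ ψ
  applyOp-pullback ∪op _ _ = refl
  applyOp-pullback ∩op _ _ = refl

  operand-pullback : (env : Vec (Subset Δ) p) (o : Operand I p) →
    operand (pullback ψ 𝒞) (map (_∘ ψ) env) o ≡ operand 𝒞 env o ∘ ψ
  operand-pullback env (inj₁ i) = refl
  operand-pullback env (inj₂ j) = lookup-map j (_∘ ψ) env

  evalSteps-pullback : (s : Steps I p) → evalSteps (pullback ψ 𝒞) s ≡ map (_∘ ψ) (evalSteps 𝒞 s)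
  evalSteps-pullback []                 = refl
  evalSteps-pullback (s ▷ step o l r) rewrite evalSteps-pullback s = begin
    env∘ψ ∷ʳ applyOp (pullback ψ 𝒞) o (operand (pullback ψ 𝒞) env∘ψ l) (operand (pullback ψ 𝒞) env∘ψ r)
      ≡⟨ cong (env∘ψ ∷ʳ_) (cong₂ (applyOp (pullback ψ 𝒞) o) (operand-pullback env l) (operand-pullback env r)) ⟩
    env∘ψ ∷ʳ applyOp (pullback ψ 𝒞) o (operand 𝒞 env l ∘ ψ) (operand 𝒞 env r ∘ ψ)
      ≡⟨ cong (env∘ψ ∷ʳ_) (applyOp-pullback o _ _) ⟩
    env∘ψ ∷ʳ (applyOp 𝒞 o (operand 𝒞 env l) (operand 𝒞 env r) ∘ ψ)
      ≡⟨ map-∷ʳ (_∘ ψ) _ env ⟨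
    map (_∘ ψ) (env ∷ʳ applyOp 𝒞 o (operand 𝒞 env l) (operand 𝒞 env r))
      ∎
    where
    open ≡-Reasoning
    env : Vec (Subset Δ) _
    env = evalSteps 𝒞 s
    env∘ψ : Vec (Subset Γ) _
    env∘ψ = map (_∘ ψ) env

  countCap-pullback : (s : Steps I p) → countCap (pullback ψ 𝒞) s ≡ countCap 𝒞 s
  countCap-pullback []                 = refl
  countCap-pullback (s ▷ step ∪op _ _) = countCap-pullback s
  countCap-pullback (s ▷ step ∩op _ _) = cong suc (countCap-pullback s)

  generatedWithCaps-pullback : {D : Subset Δ} → (D ∘ ψ) ≐ A →
    GeneratedWithCaps 𝒞 D k → GeneratedWithCaps (pullback ψ 𝒞) A k
  generatedWithCaps-pullback {A = A} {D = D} D∘ψ≐A (t , s , generates , refl) =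
    t , s , generatesA , countCap-pullback s
    where
    generatesA : Generates (pullback ψ 𝒞) s A
    generatesA x = begin
      last (evalSteps (pullback ψ 𝒞) s) x       ≡⟨ cong-app (cong last (evalSteps-pullback s)) x ⟩
      last (map (_∘ ψ) (evalSteps 𝒞 s)) x        ≡⟨ cong-app (last-map (_∘ ψ) (evalSteps 𝒞 s)) x ⟩
      last (evalSteps 𝒞 s) (ψ x)                 ≡⟨ generates (ψ x) ⟩
      D (ψ x)                                    ≡⟨ D∘ψ≐A x ⟩
      A x                                        ∎
      where open ≡-Reasoning

decodeℕ : ∀ n → Vec Bool n → ℕ
decodeℕ zero    []          = 0
decodeℕ (suc n) (true ∷ v)  = 2 ^ n + decodeℕ n v
decodeℕ (suc n) (false ∷ v) = decodeℕ n v

decodeℕ-binℕ : ∀ n m → m < 2 ^ n → decodeℕ n (binℕ n m) ≡ m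
decodeℕ-binℕ zero    zero    _          = refl
decodeℕ-binℕ zero    (suc m) (s≤s ())
decodeℕ-binℕ (suc n) m       m<2^[1+n] with 2 ^ n ≤ᵇ m in eq
... | true  = begin
  2 ^ n + decodeℕ n (binℕ n (m ∸ 2 ^ n)) ≡⟨ cong (2 ^ n +_) (decodeℕ-binℕ n (m ∸ 2 ^ n) m∸2^n<2^n) ⟩
  2 ^ n + (m ∸ 2 ^ n)                    ≡⟨ m+[n∸m]≡n 2^n≤m ⟩
  m                                      ∎
  where
  open ≡-Reasoning
  instance _ = m^n≢0 2 n
  2^n≤m : 2 ^ n ≤ m
  2^n≤m = ≤ᵇ⇒≤ (2 ^ n) m (subst T (sym eq) tt)
  -- 2 ^ suc n reduces to 2 ^ n + (2 ^ n + 0)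
  m∸2^n<2^n : m ∸ 2 ^ n < 2 ^ n
  m∸2^n<2^n = m<n+o⇒m∸n<o m (2 ^ n) (subst (m <_) (cong (2 ^ n +_) (+-identityʳ (2 ^ n))) m<2^[1+n])
... | false = decodeℕ-binℕ n m (≰⇒> (λ 2^n≤m → subst T eq (≤⇒≤ᵇ 2^n≤m)))

bin-injective : ∀ n (u v : Fin (2 ^ n)) → bin n u ≡ bin n v → u ≡ v
bin-injective n u v bu≡bv = toℕ-injective (begin
  toℕ u                       ≡⟨ decodeℕ-binℕ n (toℕ u) (toℕ<n u) ⟨
  decodeℕ n (bin n u)         ≡⟨ cong (decodeℕ n) bu≡bv ⟩
  decodeℕ n (bin n v)         ≡⟨ decodeℕ-binℕ n (toℕ v) (toℕ<n v) ⟩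
  toℕ v                       ∎)
  where open ≡-Reasoning

φ-injective : ∀ n (x y : Fin (2 ^ n) × Fin (2 ^ n)) → φ n x ≡ φ n y → x ≡ y
φ-injective n (u , v) (u′ , v′) φx≡φy =
  let bu≡bu′ , bv≡bv′ = ++-injective (bin n u) (bin n u′) φx≡φy
  in cong₂ _,_ (bin-injective n u u′ bu≡bu′) (bin-injective n v v′ bv≡bv′)

fG⁻¹1-φ : ∀ n G → (fG⁻¹1 n G ∘ φ n) ≐ G
fG⁻¹1-φ n G x = ⇔→≡ (mk⇔ sound complete)
  where
  allPairs : List (Fin (2 ^ n) × Fin (2 ^ n))
  allPairs = cartesianProduct (allFin (2 ^ n)) (allFin (2 ^ n))
  matches : Fin (2 ^ n) × Fin (2 ^ n) → Bool
  matches g = G g ∧ ⌊ ≡-dec Bool._≟_ (φ n g) (φ n x) ⌋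
  sound : fG⁻¹1 n G (φ n x) ≡ true → G x ≡ true
  sound e with g , g-matches ← Any.satisfied (any⁻ matches allPairs (Equivalence.from T-≡ e)) =
    let g∈G , φg≡φx = Equivalence.to T-∧ g-matches
    in subst (λ y → G y ≡ true) (φ-injective n g x (toWitness φg≡φx)) (Equivalence.to T-≡ g∈G)
  complete : G x ≡ true → fG⁻¹1 n G (φ n x) ≡ true
  complete x∈G = Equivalence.to T-≡ (any⁺ matches
    (Any.map (λ { refl → Equivalence.from T-≡ (∧-true⁺ x∈G (isYes-true⁺ (≡-dec Bool._≟_ (φ n x) (φ n x)) refl)) })
             (∈-cartesianProduct⁺ (∈-allFin (proj₁ x)) (∈-allFin (proj₂ x)))))

cube-lookup : ∀ {m} (i : Fin m × Bool) {v w} → lookup v (proj₁ i) ≡ lookup w (proj₁ i) → cube m i v ≡ cube m i w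
cube-lookup (_ , true)  e = e
cube-lookup (_ , false) e = cong not e

module _ (n : ℕ) where

  private
    N = 2 ^ n
    Point = Fin N × Fin N

  gridLine : Fin (n + n) → Point → Fin N ⊎ Fin N
  gridLine j (u , v) = Sum.map (const u) (const v) (splitAt n j)

  lookup-φ : ∀ x j → lookup (φ n x) j ≡ [ lookup (bin n (proj₁ x)) , lookup (bin n (proj₂ x)) ]′ (splitAt n j)
  lookup-φ (u , v) j = lookup-splitAt n (bin n u) (bin n v) j

  gridLine-∋ : ∀ j w → grid N (gridLine j w) w ≡ true
  gridLine-∋ j (u , v) with splitAt n j
  ... | inj₁ _ = isYes-true⁺ (u Fin.≟ u) refl
  ... | inj₂ _ = isYes-true⁺ (v Fin.≟ v) refl

  gridLine-lookup-φ : ∀ j w x → grid N (gridLine j w) x ≡ true → lookup (φ n x) j ≡ lookup (φ n w) j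
  gridLine-lookup-φ j (u , v) (u′ , v′) x∈line
    rewrite lookup-φ (u′ , v′) j | lookup-φ (u , v) j
    with splitAt n j
  ... | inj₁ j′ = cong (λ u → lookup (bin n u) j′) (isYes-true⁻ (u′ Fin.≟ u) x∈line)
  ... | inj₂ j′ = cong (λ v → lookup (bin n v) j′) (isYes-true⁻ (v′ Fin.≟ v) x∈line)

  grid-finer-cube∘φ : Finer (grid N) (pullback (φ n) (cube (n + n)))
  grid-finer-cube∘φ w i w∈i =
    gridLine (proj₁ i) w , gridLine-∋ (proj₁ i) w ,
    λ x x∈line → trans (cube-lookup i (gridLine-lookup-φ (proj₁ i) w x x∈line)) w∈i

proposition4p3 : (n : ℕ) → 1 ≤ n →
    (G : Subset (Fin (2 ^ n) × Fin (2 ^ n))) → NonTrivial G →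
    (k : ℕ) → GeneratedWithCaps (cube (n + n)) (fG⁻¹1 n G) k →
    ρ≤ (grid (2 ^ n)) G k
proposition4p3 n _ G _ k generated =
  ρ≤-finer (grid-finer-cube∘φ n)
    (ρ≤-generatedWithCaps _ G (generatedWithCaps-pullback (φ n) (cube (n + n)) (fG⁻¹1-φ n G) generated))
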